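{- Let $m\ge1$ be an integer, $L=\lceil\log_2(m+1)\rceil$, and let $(\beta_1,\dots,\beta_{2^L})$ be a Cantor basis of ${\rm GF}(2^{2^L})$ over ${\rm GF}(2)$ (so $1,\beta_{2^L},\dots,\beta_{2^L}^{2^L-1}$ is a ${\rm GF}(2)$-basis of ${\rm GF}(2^{2^L})$). Let $f(x)=\sum_{i=0}^{2^m-1}a_ix^i$ and $g(x)=\sum_{i=0}^{2^m-1}b_ix^i$ be polynomials over ${\rm GF}(2)$. For $i=0,\dots,2^{m-L+1}-1$ let $F_i(x)=\sum_{j=0}^{2^{L-1}-1}a_{2^{L-1}i+j}x^j$, $G_i(x)=\sum_{j=0}^{2^{L-1}-1}b_{2^{L-1}i+j}x^j$, $A_i=F_i(\beta_{2^L})$, $B_i=G_i(\beta_{2^L})$. Let $F(x)=\sum_{i=0}^{2^{m-L+1}-1}A_ix^i$, $G(x)=\sum_{i=0}^{2^{m-L+1}-1}B_ix^i$, and $H=FG=\sum_{i=0}^{2^{m-L+2}-1}C_ix^i$. For each $i$ write $C_i=\sum_{j=0}^{2^L-1}h_{ij}\beta_{2^L}^j$ with $h_{ij}\in\{0,1\}$. Then $$f(x)g(x)=\sum_{i=0}^{2^{m-L+2}-1}x^{2^{L-1}i}\sum_{j=0}^{2^L-1}h_{ij}x^j.$$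
   Context: A Cantor basis of ${\rm GF}(2^{2^L})$ over ${\rm GF}(2)$ is a ${\rm GF}(2)$-basis $(\beta_1,\dots,\beta_{2^L})$ with $\beta_1=1$ and $\beta_i^2-\beta_i=\beta_{i-1}$ for $i>1$. -}

module Defs where

open import Level using (Level)
open import Data.Nat using (ℕ; zero; suc; _+_; _*_; _∸_; _^_; _≤_; _<_; _<ᵇ_; _≡ᵇ_)
open import Data.Nat.Logarithm using (⌈log₂_⌉)
open import Data.Bool using (Bool; true; false; if_then_else_; _∧_; _xor_)
open import Data.Fin using (Fin; toℕ)
open import Data.Product using (Σ; _×_; ∃)
open import Relation.Nullary using (¬_)
open import Relation.Binary.PropositionalEquality using (_≡_)
open import Algebra.Bundles using (CommutativeRing)

Lof : ℕ → ℕ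
Lof m = ⌈log₂ (suc m) ⌉

-- Polynomials over GF(2) = Bool (xor, ∧), given by coefficient functions

xorSum : ℕ → (ℕ → Bool) → Bool
xorSum zero    f = false
xorSum (suc n) f = xorSum n f xor f n

extend : {n : ℕ} → (Fin n → Bool) → ℕ → Bool
extend {zero}  a k       = false
extend {suc n} a zero    = a Fin.zero
extend {suc n} a (suc k) = extend {n} (λ i → a (Fin.suc i)) k

mulCoeff : (ℕ → Bool) → (ℕ → Bool) → ℕ → Bool
mulCoeff a b k = xorSum (suc k) (λ j → a j ∧ b (k ∸ j))

module _ {c ℓ : Level} (K : CommutativeRing c ℓ) where
  open CommutativeRing K renaming (_+_ to _+K_; _*_ to _*K_; _-_ to _-K_)

  sumK : ℕ → (ℕ → Carrier) → Carrier
  sumK zero    f = 0#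
  sumK (suc n) f = sumK n f +K f n

  powK : Carrier → ℕ → Carrier
  powK x zero    = 1#
  powK x (suc n) = powK x n *K x

  bitK : Bool → Carrier
  bitK true  = 1#
  bitK false = 0#

  IsField : Set (c Level.⊔ ℓ)
  IsField = (¬ (1# ≈ 0#)) × (∀ x → ¬ (x ≈ 0#) → Σ Carrier λ y → x *K y ≈ 1#)

  Char2 : Set ℓ
  Char2 = 1# +K 1# ≈ 0#

  IsGF2Basis : (n : ℕ) → (ℕ → Carrier) → Set (c Level.⊔ ℓ)
  IsGF2Basis n v =
    (∀ x → Σ (ℕ → Bool) λ e → x ≈ sumK n (λ i → bitK (e i) *K v i))
    × (∀ (e e′ : ℕ → Bool) →
         sumK n (λ i → bitK (e i) *K v i) ≈ sumK n (λ i → bitK (e′ i) *K v i) →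
         ∀ i → i < n → e i ≡ e′ i)

  -- (β 1, …, β n) (paper indexing, β : ℕ → K) is a Cantor basis of K over GF(2):
  -- a GF(2)-basis with β₁ = 1 and βᵢ² − βᵢ = βᵢ₋₁ for 1 < i ≤ n.
  IsCantorBasis : (n : ℕ) → (ℕ → Carrier) → Set (c Level.⊔ ℓ)
  IsCantorBasis n β =
    IsGF2Basis n (λ i → β (suc i))
    × (β 1 ≈ 1#)
    × (∀ i → 1 < i → i ≤ n → β i *K β i -K β i ≈ β (i ∸ 1))

  blockEval : ℕ → Carrier → (ℕ → Bool) → ℕ → Carrier
  blockEval N βt a i = sumK N (λ j → bitK (a (N * i + j)) *K powK βt j)

  convK : (ℕ → Carrier) → (ℕ → Carrier) → ℕ → Carrier
  convK A B k = sumK (suc k) (λ i → A i *K B (k ∸ i))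

  powBasisSum : ℕ → Carrier → (ℕ → Bool) → Carrier
  powBasisSum n βt e = sumK n (λ j → bitK (e j) *K powK βt j)

-- Put N = 2^(L-1) and cut f and g into blocks of length N: f(x) = F̃(x^N, x) for
-- F̃(X, Y) = Σ a_{Ni+j} X^i Y^j (j < N), and likewise g = G̃(x^N, x). The product
-- F̃ G̃ has Y-degree below 2N = 2^L and f g = (F̃ G̃)(x^N, x). Substituting
-- Y = β_{2^L} instead turns F̃, G̃ into F, G, so C_i = c_i(β_{2^L}) where c_i(Y) is
-- the coefficient of X^i in F̃ G̃. Hence h_ij is the coefficient of Y^j in c_i as
-- soon as 1, β_{2^L}, …, β_{2^L}^{2^L - 1} are linearly independent over GF(2).
-- They are: if β_{2^L}^t were a combination of lower powers for some t < 2^L, the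
-- span of those t powers would be closed under multiplication, contain β_{2^L},
-- hence every β_i (as β_{i-1} = β_i² - β_i), hence all of K; but K contains the
-- 2^L independent elements β_1, …, β_{2^L}, and by Gaussian elimination a span of
-- fewer than 2^L elements does not.

module Submission where

open import Defs
open import Level using (Level; 0ℓ)
open import Algebra.Bundles using (CommutativeRing)
open import Data.Bool using (Bool; true; false; _∧_; _xor_; if_then_else_)
open import Data.Bool.Properties
  using (xor-∧-commutativeRing; ∧-distribˡ-xor; ∧-identityʳ; ∧-comm; xor-same)
open import Data.Empty using (⊥-elim)
open import Data.Fin using (Fin)
import Data.Fin as Fin
open import Data.List using (List; []; _∷_; _++_; length; map; applyUpTo)
import Data.List.Properties as List
open import Data.List.Relation.Unary.All as All using (All; []; _∷_)
import Data.List.Relation.Unary.All.Properties as All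
open import Data.Nat using (ℕ; zero; suc; _+_; _*_; _∸_; _^_; _≤_; _<_; _≡ᵇ_; z≤n; s≤s)
open import Data.Nat.Logarithm using (⌈log₂⌉-mono-≤; ⌈log₂2^n⌉≡n)
import Data.Nat.Properties as ℕ
open import Data.Nat.Tactic.RingSolver using (solve-∀)
open import Data.Product using (Σ; _×_; _,_; proj₁; proj₂)
open import Data.Sum using (_⊎_; inj₁; inj₂)
open import Function.Bundles using (_⇔_; mk⇔)
open import Relation.Nullary using (¬_; Dec; yes; no)
open import Relation.Nullary.Decidable using (dec-true; dec-false; does-⇔)
open import Relation.Binary.PropositionalEquality as ≡ using (_≡_; _≢_)

1+n≤2^n : ∀ n → suc n ≤ 2 ^ n
1+n≤2^n zero    = s≤s z≤n
1+n≤2^n (suc n) = ℕ.+-mono-≤ (ℕ.m^n>0 2 n) (ℕ.≤-trans (1+n≤2^n n) (ℕ.m≤m+n (2 ^ n) 0))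

2^[1+n]≡2^n+2^n : ∀ n → 2 ^ suc n ≡ 2 ^ n + 2 ^ n
2^[1+n]≡2^n+2^n n = ≡.cong (2 ^ n +_) (ℕ.+-identityʳ (2 ^ n))

1≤Lof : ∀ {m} → 1 ≤ m → 1 ≤ Lof m
1≤Lof {m} 1≤m = ≡.subst (_≤ Lof m) (⌈log₂2^n⌉≡n 1) (⌈log₂⌉-mono-≤ (s≤s 1≤m))

Lof≤ : ∀ m → Lof m ≤ m
Lof≤ m = ≡.subst (Lof m ≤_) (⌈log₂2^n⌉≡n m) (⌈log₂⌉-mono-≤ (1+n≤2^n m))

blockIndex-+ : ∀ N i₁ j₁ i₂ j₂ → N * (i₁ + i₂) + (j₁ + j₂) ≡ (N * i₁ + j₁) + (N * i₂ + j₂)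
blockIndex-+ = solve-∀

extend-≥ : ∀ {n} (a : Fin n → Bool) t → n ≤ t → extend a t ≡ false
extend-≥ {zero}  a t       _         = ≡.refl
extend-≥ {suc n} a (suc t) (s≤s n≤t) = extend-≥ (λ i → a (Fin.suc i)) t n≤t

xor≡false⇒≡ : ∀ x y → x xor y ≡ false → x ≡ y
xor≡false⇒≡ false false _ = ≡.refl
xor≡false⇒≡ true  true  _ = ≡.refl

module FiniteSums {c ℓ : Level} (R : CommutativeRing c ℓ) where
  open CommutativeRing R hiding (zero) renaming (_+_ to _+ᴿ_; _*_ to _*ᴿ_)
  open import Relation.Binary.Reasoning.Setoid setoid
  open import Algebra.Properties.CommutativeSemigroup +-commutativeSemigroup
    using () renaming (interchange to +-interchange)

  ∑ : ℕ → (ℕ → Carrier) → Carrier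
  ∑ = sumK R

  syntax ∑ n (λ i → f) = ∑[ i < n ] f

  ⟦_⟧ : Bool → Carrier
  ⟦_⟧ = bitK R

  _^ᴿ_ : Carrier → ℕ → Carrier
  _^ᴿ_ = powK R

  ∑-cong : ∀ n {f g} → (∀ i → i < n → f i ≈ g i) → ∑ n f ≈ ∑ n g
  ∑-cong zero    f≈g = refl
  ∑-cong (suc n) f≈g = +-cong (∑-cong n (λ i i<n → f≈g i (ℕ.m<n⇒m<1+n i<n))) (f≈g n (ℕ.n<1+n n))

  ∑-cong′ : ∀ n {f g} → (∀ i → f i ≈ g i) → ∑ n f ≈ ∑ n g
  ∑-cong′ n f≈g = ∑-cong n (λ i _ → f≈g i)

  ∑-zero : ∀ n {f} → (∀ i → i < n → f i ≈ 0#) → ∑ n f ≈ 0#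
  ∑-zero zero    f≈0 = refl
  ∑-zero (suc n) f≈0 =
    trans (+-cong (∑-zero n (λ i i<n → f≈0 i (ℕ.m<n⇒m<1+n i<n))) (f≈0 n (ℕ.n<1+n n))) (+-identityʳ 0#)

  ∑-+ : ∀ n f g → ∑[ i < n ] (f i +ᴿ g i) ≈ ∑ n f +ᴿ ∑ n g
  ∑-+ zero    f g = sym (+-identityˡ 0#)
  ∑-+ (suc n) f g = trans (+-congʳ (∑-+ n f g)) (+-interchange _ _ _ _)

  *-distribˡ-∑ : ∀ n x f → x *ᴿ ∑ n f ≈ ∑[ i < n ] (x *ᴿ f i)
  *-distribˡ-∑ zero    x f = zeroʳ x
  *-distribˡ-∑ (suc n) x f = trans (distribˡ x _ _) (+-congʳ (*-distribˡ-∑ n x f))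

  *-distribʳ-∑ : ∀ n x f → ∑ n f *ᴿ x ≈ ∑[ i < n ] (f i *ᴿ x)
  *-distribʳ-∑ n x f = trans (*-comm _ x) (trans (*-distribˡ-∑ n x f) (∑-cong′ n (λ i → *-comm x (f i))))

  ∑-*-∑ : ∀ m n f g → ∑ m f *ᴿ ∑ n g ≈ ∑[ i < m ] ∑[ j < n ] (f i *ᴿ g j)
  ∑-*-∑ m n f g = trans (*-distribʳ-∑ m _ f) (∑-cong′ m (λ i → *-distribˡ-∑ n (f i) g))

  ∑-comm : ∀ m n (f : ℕ → ℕ → Carrier) → ∑[ i < m ] ∑[ j < n ] f i j ≈ ∑[ j < n ] ∑[ i < m ] f i j
  ∑-comm zero    n f = sym (∑-zero n (λ _ _ → refl))
  ∑-comm (suc m) n f = trans (+-congʳ (∑-comm m n f)) (sym (∑-+ n _ _))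

  ∑-split : ∀ m n f → ∑ (m + n) f ≈ ∑ m f +ᴿ ∑[ i < n ] f (m + i)
  ∑-split m zero    f rewrite ℕ.+-identityʳ m = sym (+-identityʳ _)
  ∑-split m (suc n) f rewrite ℕ.+-suc m n = trans (+-congʳ (∑-split m n f)) (+-assoc _ _ _)

  ∑-block : ∀ p N f → ∑ (p * N) f ≈ ∑[ i < p ] ∑[ j < N ] f (N * i + j)
  ∑-block zero    N f = refl
  ∑-block (suc p) N f rewrite ℕ.+-comm N (p * N) =
    trans (∑-split (p * N) N f)
          (+-cong (∑-block p N f) (∑-cong′ N (λ j → reflexive (≡.cong (λ q → f (q + j)) (ℕ.*-comm p N)))))

  ∑-tail : ∀ m d f → (∀ i → m ≤ i → f i ≈ 0#) → ∑ (m + d) f ≈ ∑ m f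
  ∑-tail m d f f≈0 =
    trans (∑-split m d f) (trans (+-congˡ (∑-zero d (λ i _ → f≈0 (m + i) (ℕ.m≤m+n m i)))) (+-identityʳ _))

  ∑-support : ∀ m n f → (∀ i → m ≤ i → f i ≈ 0#) → (∀ i → n ≤ i → f i ≈ 0#) → ∑ m f ≈ ∑ n f
  ∑-support m n f m≤⇒0 n≤⇒0 with ℕ.≤-total m n
  ... | inj₁ m≤n = sym (≡.subst (λ k → ∑ k f ≈ ∑ m f) (ℕ.m+[n∸m]≡n m≤n) (∑-tail m (n ∸ m) f m≤⇒0))
  ... | inj₂ n≤m = ≡.subst (λ k → ∑ k f ≈ ∑ n f) (ℕ.m+[n∸m]≡n n≤m) (∑-tail n (m ∸ n) f n≤⇒0)

  ⟦∧⟧ : ∀ x y → ⟦ x ∧ y ⟧ ≈ ⟦ x ⟧ *ᴿ ⟦ y ⟧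
  ⟦∧⟧ false y = sym (zeroˡ _)
  ⟦∧⟧ true  y = sym (*-identityˡ _)

  δ-≢ : ∀ x y → x ≢ y → ⟦ x ≡ᵇ y ⟧ ≈ 0#
  δ-≢ x y x≢y = reflexive (≡.cong ⟦_⟧ (dec-false (x ℕ.≟ y) x≢y))

  δ-refl : ∀ x → ⟦ x ≡ᵇ x ⟧ ≈ 1#
  δ-refl x = reflexive (≡.cong ⟦_⟧ (dec-true (x ℕ.≟ x) ≡.refl))

  δ-cong : ∀ x y u v → (x ≡ y ⇔ u ≡ v) → ⟦ x ≡ᵇ y ⟧ ≈ ⟦ u ≡ᵇ v ⟧
  δ-cong x y u v x≡y⇔u≡v = reflexive (≡.cong ⟦_⟧ (does-⇔ x≡y⇔u≡v (x ℕ.≟ y) (u ℕ.≟ v)))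

  ∑-δ-out : ∀ n x (f : ℕ → Carrier) → n ≤ x → ∑[ j < n ] (⟦ x ≡ᵇ j ⟧ *ᴿ f j) ≈ 0#
  ∑-δ-out n x f n≤x =
    ∑-zero n (λ j j<n → trans (*-congʳ (δ-≢ x j (λ x≡j → ℕ.<⇒≱ j<n (≡.subst (n ≤_) x≡j n≤x)))) (zeroˡ _))

  ∑-δ : ∀ n x (f : ℕ → Carrier) → x < n → ∑[ j < n ] (⟦ x ≡ᵇ j ⟧ *ᴿ f j) ≈ f x
  ∑-δ (suc n) x f x<1+n with ℕ.m≤n⇒m<n∨m≡n (ℕ.≤-pred x<1+n)
  ... | inj₁ x<n    = trans (+-cong (∑-δ n x f x<n) (trans (*-congʳ (δ-≢ x n (ℕ.<⇒≢ x<n))) (zeroˡ _)))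
                            (+-identityʳ _)
  ... | inj₂ ≡.refl = trans (+-cong (∑-δ-out n n f ℕ.≤-refl) (trans (*-congʳ (δ-refl n)) (*-identityˡ _)))
                            (+-identityˡ _)

  ∑-δ₂ : ∀ m n x y (f : ℕ → ℕ → Carrier) → x < m → y < n →
         ∑[ i < m ] ∑[ j < n ] (⟦ x ≡ᵇ i ⟧ *ᴿ (⟦ y ≡ᵇ j ⟧ *ᴿ f i j)) ≈ f x y
  ∑-δ₂ m n x y f x<m y<n =
    trans (∑-cong′ m (λ i → trans (sym (*-distribˡ-∑ n _ _)) (*-congˡ (∑-δ n y (f i) y<n))))
          (∑-δ m x (λ i → f i y) x<m)

  ^ᴿ-+ : ∀ x i j → x ^ᴿ (i + j) ≈ x ^ᴿ i *ᴿ x ^ᴿ j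
  ^ᴿ-+ x i zero    rewrite ℕ.+-identityʳ i = sym (*-identityʳ _)
  ^ᴿ-+ x i (suc j) rewrite ℕ.+-suc i j = trans (*-congʳ (^ᴿ-+ x i j)) (*-assoc _ _ _)

  pairSum : ℕ → (ℕ → ℕ → Carrier) → ℕ → Carrier
  pairSum V w k = ∑[ s < V ] ∑[ t < V ] (⟦ s + t ≡ᵇ k ⟧ *ᴿ w s t)

  convK≈pairSum : ∀ V (u v : ℕ → Carrier) → (∀ t → V ≤ t → u t ≈ 0#) → (∀ t → V ≤ t → v t ≈ 0#) →
                  ∀ k → convK R u v k ≈ pairSum V (λ s t → u s *ᴿ v t) k
  convK≈pairSum V u v u≈0 v≈0 k = begin
    ∑[ s < suc k ] (u s *ᴿ v (k ∸ s)) ≈⟨ ∑-cong (suc k) (λ s s<1+k → sym (column-≤ s (ℕ.≤-pred s<1+k))) ⟩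
    ∑ (suc k) column                  ≈⟨ ∑-support (suc k) V column column-> column-V ⟩
    ∑ V column                        ∎
    where
    column : ℕ → Carrier
    column s = ∑[ t < V ] (⟦ s + t ≡ᵇ k ⟧ *ᴿ (u s *ᴿ v t))

    column-≤ : ∀ s → s ≤ k → column s ≈ u s *ᴿ v (k ∸ s)
    column-≤ s s≤k =
      trans (∑-cong′ V (λ t → *-congʳ (δ-cong (s + t) k (k ∸ s) t s+t≡k⇔k∸s≡t))) (collapse (k ∸ s ℕ.<? V))
      where
      s+t≡k⇔k∸s≡t : ∀ {t} → s + t ≡ k ⇔ k ∸ s ≡ t
      s+t≡k⇔k∸s≡t {t} = mk⇔ (λ s+t≡k → ≡.trans (≡.cong (_∸ s) (≡.sym s+t≡k)) (ℕ.m+n∸m≡n s t))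
                            (λ k∸s≡t → ≡.trans (≡.cong (s +_) (≡.sym k∸s≡t)) (ℕ.m+[n∸m]≡n s≤k))

      collapse : Dec (k ∸ s < V) → ∑[ t < V ] (⟦ k ∸ s ≡ᵇ t ⟧ *ᴿ (u s *ᴿ v t)) ≈ u s *ᴿ v (k ∸ s)
      collapse (yes k∸s<V) = ∑-δ V (k ∸ s) _ k∸s<V
      collapse (no  k∸s≮V) = trans (∑-δ-out V (k ∸ s) _ (ℕ.≮⇒≥ k∸s≮V))
                                   (sym (trans (*-congˡ (v≈0 _ (ℕ.≮⇒≥ k∸s≮V))) (zeroʳ _)))

    column-> : ∀ s → suc k ≤ s → column s ≈ 0#
    column-> s k<s = ∑-zero V (λ t _ → trans (*-congʳ (δ-≢ (s + t) k (λ s+t≡k →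
      ℕ.<⇒≱ k<s (≡.subst (s ≤_) s+t≡k (ℕ.m≤m+n s t))))) (zeroˡ _))

    column-V : ∀ s → V ≤ s → column s ≈ 0#
    column-V s V≤s = ∑-zero V (λ t _ → trans (*-congˡ (trans (*-congʳ (u≈0 s V≤s)) (zeroˡ _))) (zeroʳ _))

-- blockCoeff i j is the coefficient of X^i Y^j in F̃ G̃, where F̃ = Σ α(N i + j) X^i Y^j
-- and G̃ = Σ γ(N i + j) X^i Y^j over i < P, j < N.
module BlockProduct {c ℓ : Level} (R : CommutativeRing c ℓ) (N P : ℕ)
                    (α γ : ℕ → CommutativeRing.Carrier R) where
  open CommutativeRing R hiding (zero) renaming (_+_ to _+ᴿ_; _*_ to _*ᴿ_)
  open FiniteSums R
  open import Relation.Binary.Reasoning.Setoid setoid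
  open import Algebra.Properties.CommutativeSemigroup *-commutativeSemigroup using (x∙yz≈y∙xz; interchange)

  ∑⁴ : (ℕ → ℕ → ℕ → ℕ → Carrier) → Carrier
  ∑⁴ F = ∑[ i₁ < P ] ∑[ j₁ < N ] ∑[ i₂ < P ] ∑[ j₂ < N ] F i₁ j₁ i₂ j₂

  ∑⁴-cong : ∀ {F G} → (∀ i₁ j₁ i₂ j₂ → i₁ < P → j₁ < N → i₂ < P → j₂ < N → F i₁ j₁ i₂ j₂ ≈ G i₁ j₁ i₂ j₂) →
            ∑⁴ F ≈ ∑⁴ G
  ∑⁴-cong F≈G = ∑-cong P λ i₁ i₁<P → ∑-cong N λ j₁ j₁<N → ∑-cong P λ i₂ i₂<P → ∑-cong N λ j₂ j₂<N →
                F≈G i₁ j₁ i₂ j₂ i₁<P j₁<N i₂<P j₂<N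

  ∑-∑⁴-comm : ∀ n (F : ℕ → ℕ → ℕ → ℕ → ℕ → Carrier) →
              ∑[ k < n ] ∑⁴ (F k) ≈ ∑⁴ (λ i₁ j₁ i₂ j₂ → ∑[ k < n ] F k i₁ j₁ i₂ j₂)
  ∑-∑⁴-comm n F = trans (∑-comm n P _) (∑-cong′ P λ _ → trans (∑-comm n N _) (∑-cong′ N λ _ →
                  trans (∑-comm n P _) (∑-cong′ P λ _ → ∑-comm n N _)))

  *-distribˡ-∑⁴ : ∀ x F → x *ᴿ ∑⁴ F ≈ ∑⁴ (λ i₁ j₁ i₂ j₂ → x *ᴿ F i₁ j₁ i₂ j₂)
  *-distribˡ-∑⁴ x F = trans (*-distribˡ-∑ P x _) (∑-cong′ P λ _ → trans (*-distribˡ-∑ N x _) (∑-cong′ N λ _ →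
                      trans (*-distribˡ-∑ P x _) (∑-cong′ P λ _ → *-distribˡ-∑ N x _)))

  *-distribʳ-∑⁴ : ∀ x F → ∑⁴ F *ᴿ x ≈ ∑⁴ (λ i₁ j₁ i₂ j₂ → F i₁ j₁ i₂ j₂ *ᴿ x)
  *-distribʳ-∑⁴ x F = trans (*-comm _ x) (trans (*-distribˡ-∑⁴ x F) (∑⁴-cong λ _ _ _ _ _ _ _ _ → *-comm x _))

  term : ℕ → ℕ → ℕ → ℕ → Carrier
  term i₁ j₁ i₂ j₂ = α (N * i₁ + j₁) *ᴿ γ (N * i₂ + j₂)

  blockSummand : ℕ → ℕ → ℕ → ℕ → ℕ → ℕ → Carrier
  blockSummand i j i₁ j₁ i₂ j₂ = ⟦ i₁ + i₂ ≡ᵇ i ⟧ *ᴿ (⟦ j₁ + j₂ ≡ᵇ j ⟧ *ᴿ term i₁ j₁ i₂ j₂)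

  blockCoeff : ℕ → ℕ → Carrier
  blockCoeff i j = ∑⁴ (blockSummand i j)

  evalBlock : Carrier → (ℕ → Carrier) → ℕ → Carrier
  evalBlock x δ i = ∑[ j < N ] (δ (N * i + j) *ᴿ x ^ᴿ j)

  evalBlock-* : ∀ x i₁ i₂ →
    evalBlock x α i₁ *ᴿ evalBlock x γ i₂ ≈ ∑[ j₁ < N ] ∑[ j₂ < N ] (term i₁ j₁ i₂ j₂ *ᴿ x ^ᴿ (j₁ + j₂))
  evalBlock-* x i₁ i₂ = trans (∑-*-∑ N N _ _) (∑-cong′ N λ j₁ → ∑-cong′ N λ j₂ →
    trans (interchange _ _ _ _) (*-congˡ (sym (^ᴿ-+ x j₁ j₂))))

  evalBlock≈0 : ∀ {δ} x → (∀ t → P * N ≤ t → δ t ≈ 0#) → ∀ i → P ≤ i → evalBlock x δ i ≈ 0#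
  evalBlock≈0 x δ≈0 i P≤i = ∑-zero N λ j _ → trans (*-congʳ (δ≈0 _ (P*N≤N*i+j j))) (zeroˡ _)
    where
    P*N≤N*i+j : ∀ j → P * N ≤ N * i + j
    P*N≤N*i+j j = ℕ.≤-trans (ℕ.≤-reflexive (ℕ.*-comm P N)) (ℕ.≤-trans (ℕ.*-monoʳ-≤ N P≤i) (ℕ.m≤m+n (N * i) j))

  module _ (α≈0 : ∀ t → P * N ≤ t → α t ≈ 0#) (γ≈0 : ∀ t → P * N ≤ t → γ t ≈ 0#) where

    convK-evalBlock : ∀ x i →
      convK R (evalBlock x α) (evalBlock x γ) i ≈ ∑[ j < N + N ] (blockCoeff i j *ᴿ x ^ᴿ j)
    convK-evalBlock x i = begin
      convK R (evalBlock x α) (evalBlock x γ) i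
        ≈⟨ convK≈pairSum P _ _ (evalBlock≈0 x α≈0) (evalBlock≈0 x γ≈0) i ⟩
      ∑[ i₁ < P ] ∑[ i₂ < P ] (⟦ i₁ + i₂ ≡ᵇ i ⟧ *ᴿ (evalBlock x α i₁ *ᴿ evalBlock x γ i₂))
        ≈⟨ ∑-cong′ P (λ i₁ → ∑-cong′ P λ i₂ → trans (*-congˡ (evalBlock-* x i₁ i₂))
                      (trans (*-distribˡ-∑ N _ _) (∑-cong′ N λ _ → *-distribˡ-∑ N _ _))) ⟩
      ∑[ i₁ < P ] ∑[ i₂ < P ] ∑[ j₁ < N ] ∑[ j₂ < N ] (⟦ i₁ + i₂ ≡ᵇ i ⟧ *ᴿ monomial i₁ j₁ i₂ j₂)
        ≈⟨ ∑-cong′ P (λ _ → ∑-comm P N _) ⟩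
      ∑⁴ (λ i₁ j₁ i₂ j₂ → ⟦ i₁ + i₂ ≡ᵇ i ⟧ *ᴿ monomial i₁ j₁ i₂ j₂)
        ≈⟨ ∑⁴-cong (λ i₁ j₁ i₂ j₂ _ j₁<N _ j₂<N → sym (expand-power i₁ j₁ i₂ j₂ (ℕ.+-mono-< j₁<N j₂<N))) ⟩
      ∑⁴ (λ i₁ j₁ i₂ j₂ → ∑[ j < N + N ] (blockSummand i j i₁ j₁ i₂ j₂ *ᴿ x ^ᴿ j))
        ≈⟨ ∑-∑⁴-comm (N + N) _ ⟨
      ∑[ j < N + N ] ∑⁴ (λ i₁ j₁ i₂ j₂ → blockSummand i j i₁ j₁ i₂ j₂ *ᴿ x ^ᴿ j)
        ≈⟨ ∑-cong′ (N + N) (λ j → *-distribʳ-∑⁴ _ _) ⟨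
      ∑[ j < N + N ] (blockCoeff i j *ᴿ x ^ᴿ j) ∎
      where
      monomial : ℕ → ℕ → ℕ → ℕ → Carrier
      monomial i₁ j₁ i₂ j₂ = term i₁ j₁ i₂ j₂ *ᴿ x ^ᴿ (j₁ + j₂)

      expand-power : ∀ i₁ j₁ i₂ j₂ → j₁ + j₂ < N + N →
        ∑[ j < N + N ] (blockSummand i j i₁ j₁ i₂ j₂ *ᴿ x ^ᴿ j) ≈ ⟦ i₁ + i₂ ≡ᵇ i ⟧ *ᴿ monomial i₁ j₁ i₂ j₂
      expand-power i₁ j₁ i₂ j₂ j₁+j₂<2N =
        trans (∑-cong′ (N + N) λ _ → trans (*-congʳ (x∙yz≈y∙xz _ _ _)) (*-assoc _ _ _))
              (trans (∑-δ (N + N) (j₁ + j₂) _ j₁+j₂<2N) (*-assoc _ _ _))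

    -- f g = (F̃ G̃)(x^N, x), coefficientwise.
    convK-flatten : ∀ k → convK R α γ k ≈ ∑[ i < P + P ] ∑[ j < N + N ] (⟦ N * i + j ≡ᵇ k ⟧ *ᴿ blockCoeff i j)
    convK-flatten k = begin
      convK R α γ k
        ≈⟨ convK≈pairSum (P * N) α γ α≈0 γ≈0 k ⟩
      pairSum (P * N) (λ s t → α s *ᴿ γ t) k
        ≈⟨ trans (∑-block P N _) (∑-cong′ P λ _ → ∑-cong′ N λ _ → ∑-block P N _) ⟩
      ∑⁴ (λ i₁ j₁ i₂ j₂ → ⟦ (N * i₁ + j₁) + (N * i₂ + j₂) ≡ᵇ k ⟧ *ᴿ term i₁ j₁ i₂ j₂)
        ≈⟨ ∑⁴-cong (λ i₁ j₁ i₂ j₂ i₁<P j₁<N i₂<P j₂<N →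
             sym (collapse i₁ j₁ i₂ j₂ (ℕ.+-mono-< i₁<P i₂<P) (ℕ.+-mono-< j₁<N j₂<N))) ⟩
      ∑⁴ (λ i₁ j₁ i₂ j₂ → ∑[ i < P + P ] ∑[ j < N + N ] (⟦ N * i + j ≡ᵇ k ⟧ *ᴿ blockSummand i j i₁ j₁ i₂ j₂))
        ≈⟨ trans (∑-cong′ (P + P) λ _ → ∑-∑⁴-comm (N + N) _) (∑-∑⁴-comm (P + P) _) ⟨
      ∑[ i < P + P ] ∑[ j < N + N ] ∑⁴ (λ i₁ j₁ i₂ j₂ → ⟦ N * i + j ≡ᵇ k ⟧ *ᴿ blockSummand i j i₁ j₁ i₂ j₂)
        ≈⟨ ∑-cong′ (P + P) (λ _ → ∑-cong′ (N + N) λ _ → *-distribˡ-∑⁴ _ _) ⟨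
      ∑[ i < P + P ] ∑[ j < N + N ] (⟦ N * i + j ≡ᵇ k ⟧ *ᴿ blockCoeff i j) ∎
      where
      collapse : ∀ i₁ j₁ i₂ j₂ → i₁ + i₂ < P + P → j₁ + j₂ < N + N →
        ∑[ i < P + P ] ∑[ j < N + N ] (⟦ N * i + j ≡ᵇ k ⟧ *ᴿ blockSummand i j i₁ j₁ i₂ j₂)
          ≈ ⟦ (N * i₁ + j₁) + (N * i₂ + j₂) ≡ᵇ k ⟧ *ᴿ term i₁ j₁ i₂ j₂
      collapse i₁ j₁ i₂ j₂ i<2P j<2N =
        trans (∑-cong′ (P + P) λ _ → ∑-cong′ (N + N) λ _ → trans (x∙yz≈y∙xz _ _ _) (*-congˡ (x∙yz≈y∙xz _ _ _)))
              (trans (∑-δ₂ (P + P) (N + N) (i₁ + i₂) (j₁ + j₂) _ i<2P j<2N)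
                     (*-congʳ (reflexive (≡.cong (λ n → ⟦ n ≡ᵇ k ⟧) (blockIndex-+ N i₁ j₁ i₂ j₂)))))

GF₂ : CommutativeRing 0ℓ 0ℓ
GF₂ = xor-∧-commutativeRing

module 𝔽₂ = FiniteSums GF₂

𝔽₂-⟦⟧ : ∀ x → 𝔽₂.⟦ x ⟧ ≡ x
𝔽₂-⟦⟧ false = ≡.refl
𝔽₂-⟦⟧ true  = ≡.refl

xorSum≡∑ : ∀ n f → xorSum n f ≡ 𝔽₂.∑ n f
xorSum≡∑ zero    f = ≡.refl
xorSum≡∑ (suc n) f = ≡.cong (_xor f n) (xorSum≡∑ n f)

dot : ℕ → (ℕ → Bool) → (ℕ → Bool) → Bool
dot n e r = 𝔽₂.∑ n (λ i → e i ∧ r i)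

dot-linear : ∀ n e s x r → dot n e (λ i → s i xor (x ∧ r i)) ≡ dot n e s xor (x ∧ dot n e r)
dot-linear n e s x r =
  ≡.trans (𝔽₂.∑-cong′ n distribute)
          (≡.trans (𝔽₂.∑-+ n _ _) (≡.cong (dot n e s xor_) (≡.sym (𝔽₂.*-distribˡ-∑ n x _))))
  where
  open import Algebra.Properties.CommutativeSemigroup (CommutativeRing.*-commutativeSemigroup GF₂)
    using (x∙yz≈y∙xz)

  distribute : ∀ i → e i ∧ (s i xor (x ∧ r i)) ≡ e i ∧ s i xor x ∧ (e i ∧ r i)
  distribute i = ≡.trans (∧-distribˡ-xor (e i) (s i) _) (≡.cong (e i ∧ s i xor_) (x∙yz≈y∙xz (e i) x (r i)))

Nontrivial : ℕ → (ℕ → Bool) → Set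
Nontrivial n e = Σ ℕ λ j → j < n × e j ≡ true

pivot-row : ∀ p (rs : List (ℕ → Bool)) →
  All (λ r → r p ≡ false) rs ⊎
  Σ (List (ℕ → Bool)) λ xs → Σ (ℕ → Bool) λ r → Σ (List (ℕ → Bool)) λ ys → rs ≡ xs ++ r ∷ ys × r p ≡ true
pivot-row p [] = inj₁ []
pivot-row p (r ∷ rs) with r p in r[p]
... | true = inj₂ ([] , r , rs , ≡.refl , r[p])
... | false with pivot-row p rs
...   | inj₁ column-zero                   = inj₁ (r[p] ∷ column-zero)
...   | inj₂ (xs , r′ , ys , rs≡ , r′[p]) = inj₂ (r ∷ xs , r′ , ys , ≡.cong (r ∷_) rs≡ , r′[p])

-- Gaussian elimination of the last unknown.
fewer-equations⇒nontrivial-solution : ∀ n (rs : List (ℕ → Bool)) → length rs < n →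
  Σ (ℕ → Bool) λ e → Nontrivial n e × All (λ r → dot n e r ≡ false) rs
fewer-equations⇒nontrivial-solution (suc n) rs |rs|<1+n with pivot-row n rs
... | inj₁ column-zero =
  (λ i → 𝔽₂.⟦ n ≡ᵇ i ⟧) , (n , ℕ.≤-refl , 𝔽₂.δ-refl n) ,
  All.map (λ r[n]≡false → ≡.trans (𝔽₂.∑-δ (suc n) n _ ℕ.≤-refl) r[n]≡false) column-zero
... | inj₂ (xs , r , ys , ≡.refl , r[n]) =
  extend-solution (fewer-equations⇒nontrivial-solution n reduced |reduced|<n)
  where
  eliminate : (ℕ → Bool) → ℕ → Bool
  eliminate s i = s i xor (s n ∧ r i)

  reduced : List (ℕ → Bool)
  reduced = map eliminate (xs ++ ys)

  |reduced|<n : length reduced < n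
  |reduced|<n = ≡.subst (_< n) (≡.sym (List.length-map eliminate (xs ++ ys)))
                  (ℕ.≤-pred (≡.subst (_< suc n) (List.length-++-sucʳ xs r ys) |rs|<1+n))

  extend-solution : Σ (ℕ → Bool) (λ e → Nontrivial n e × All (λ s → dot n e s ≡ false) reduced) →
                    Σ (ℕ → Bool) (λ e → Nontrivial (suc n) e × All (λ s → dot (suc n) e s ≡ false) (xs ++ r ∷ ys))
  extend-solution (e , (j , j<n , e[j]) , solves) =
    e⁺ , (j , ℕ.m<n⇒m<1+n j<n , ≡.trans (e⁺-below j j<n) e[j]) ,
    All.++⁺ (All.++⁻ˡ xs solves⁺) (solves-r ∷ All.++⁻ʳ xs solves⁺)
    where
    e⁺ : ℕ → Bool
    e⁺ i = if i ≡ᵇ n then dot n e r else e i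

    e⁺-below : ∀ i → i < n → e⁺ i ≡ e i
    e⁺-below i i<n rewrite dec-false (i ℕ.≟ n) (ℕ.<⇒≢ i<n) = ≡.refl

    dot-e⁺ : ∀ s → dot (suc n) e⁺ s ≡ dot n e s xor (dot n e r ∧ s n)
    dot-e⁺ s rewrite dec-true (n ℕ.≟ n) ≡.refl =
      ≡.cong (_xor (dot n e r ∧ s n)) (𝔽₂.∑-cong n (λ i i<n → ≡.cong (_∧ s i) (e⁺-below i i<n)))

    solves-r : dot (suc n) e⁺ r ≡ false
    solves-r rewrite dot-e⁺ r | r[n] | ∧-identityʳ (dot n e r) = xor-same (dot n e r)

    solves⁺ : All (λ s → dot (suc n) e⁺ s ≡ false) (xs ++ ys)
    solves⁺ = All.map solves-eliminated (All.map⁻ solves)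
      where
      open ≡.≡-Reasoning
      solves-eliminated : ∀ {s} → dot n e (eliminate s) ≡ false → dot (suc n) e⁺ s ≡ false
      solves-eliminated {s} dot≡false = begin
        dot (suc n) e⁺ s                   ≡⟨ dot-e⁺ s ⟩
        dot n e s xor (dot n e r ∧ s n)    ≡⟨ ≡.cong (dot n e s xor_) (∧-comm _ (s n)) ⟩
        dot n e s xor (s n ∧ dot n e r)    ≡⟨ dot-linear n e s (s n) r ⟨
        dot n e (eliminate s)              ≡⟨ dot≡false ⟩
        false                              ∎

cantor-descent : ∀ {c ℓ} (K : CommutativeRing c ℓ) →
  let open CommutativeRing K using (Carrier; _≈_) renaming (_*_ to _*ᴿ_; _-_ to _-ᴿ_) in
  ∀ {n β} → IsCantorBasis K n β → ∀ {q} (Q : Carrier → Set q) →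
  (∀ {x y} → x ≈ y → Q x → Q y) → (∀ {x} → Q x → Q (x *ᴿ x -ᴿ x)) →
  Q (β n) → ∀ i → 1 ≤ i → i ≤ n → Q (β i)
cantor-descent K {n} {β} (_ , _ , recursion) Q resp closed Q[βn] i 1≤i i≤n =
  descend (n ∸ i) i 1≤i (ℕ.m∸n+n≡m i≤n)
  where
  descend : ∀ q i → 1 ≤ i → q + i ≡ n → Q (β i)
  descend zero    i _   ≡.refl   = Q[βn]
  descend (suc q) i 1≤i q+1+i≡n =
    resp (recursion (suc i) (s≤s 1≤i) (≡.subst (suc i ≤_) q+1+i≡n (s≤s (ℕ.m≤n+m i q))))
         (closed (descend q (suc i) (s≤s z≤n) (≡.trans (ℕ.+-suc q i) q+1+i≡n)))

module Characteristic2 {c ℓ : Level} (K : CommutativeRing c ℓ) (char2 : Char2 K) where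
  open CommutativeRing K hiding (zero) renaming (_+_ to _+ᴿ_; _*_ to _*ᴿ_; _-_ to _-ᴿ_)
  open FiniteSums K
  open import Relation.Binary.Reasoning.Setoid setoid
  open import Algebra.Properties.CommutativeSemigroup *-commutativeSemigroup using (x∙yz≈y∙xz)

  x+x≈0 : ∀ x → x +ᴿ x ≈ 0#
  x+x≈0 x = begin
    x +ᴿ x             ≈⟨ +-cong (*-identityˡ x) (*-identityˡ x) ⟨
    1# *ᴿ x +ᴿ 1# *ᴿ x ≈⟨ distribʳ x 1# 1# ⟨
    (1# +ᴿ 1#) *ᴿ x    ≈⟨ *-congʳ char2 ⟩
    0# *ᴿ x            ≈⟨ zeroˡ x ⟩
    0#                 ∎

  x+y≈0⇒y≈x : ∀ {x y} → x +ᴿ y ≈ 0# → y ≈ x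
  x+y≈0⇒y≈x {x} {y} x+y≈0 = begin
    y             ≈⟨ +-identityˡ y ⟨
    0# +ᴿ y       ≈⟨ +-congʳ (x+x≈0 x) ⟨
    (x +ᴿ x) +ᴿ y ≈⟨ +-assoc x x y ⟩
    x +ᴿ (x +ᴿ y) ≈⟨ +-congˡ x+y≈0 ⟩
    x +ᴿ 0#       ≈⟨ +-identityʳ x ⟩
    x             ∎

  -x≈x : ∀ x → - x ≈ x
  -x≈x x = x+y≈0⇒y≈x (-‿inverseʳ x)

  ⟦xor⟧ : ∀ x y → ⟦ x xor y ⟧ ≈ ⟦ x ⟧ +ᴿ ⟦ y ⟧
  ⟦xor⟧ false y     = sym (+-identityˡ _)
  ⟦xor⟧ true  false = sym (+-identityʳ _)
  ⟦xor⟧ true  true  = sym char2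

  ⟦∑⟧ : ∀ n f {g} → (∀ i → ⟦ f i ⟧ ≈ g i) → ⟦ 𝔽₂.∑ n f ⟧ ≈ ∑ n g
  ⟦∑⟧ zero    f f≈g = refl
  ⟦∑⟧ (suc n) f f≈g = trans (⟦xor⟧ (𝔽₂.∑ n f) (f n)) (+-cong (⟦∑⟧ n f f≈g) (f≈g n))

  ⟦dot⟧ : ∀ n e r → ⟦ dot n e r ⟧ ≈ ∑[ i < n ] (⟦ e i ⟧ *ᴿ ⟦ r i ⟧)
  ⟦dot⟧ n e r = ⟦∑⟧ n _ (λ i → ⟦∧⟧ (e i) (r i))

  ⟦blockCoeff⟧ : ∀ N P a b i j →
    ⟦ BlockProduct.blockCoeff GF₂ N P a b i j ⟧
      ≈ BlockProduct.blockCoeff K N P (λ t → ⟦ a t ⟧) (λ t → ⟦ b t ⟧) i j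
  ⟦blockCoeff⟧ N P a b i j = ⟦∑⟧ P _ λ i₁ → ⟦∑⟧ N _ λ j₁ → ⟦∑⟧ P _ λ i₂ → ⟦∑⟧ N _ λ j₂ →
    ⟦term⟧ (i₁ + i₂ ≡ᵇ i) (j₁ + j₂ ≡ᵇ j) (a (N * i₁ + j₁)) (b (N * i₂ + j₂))
    where
    ⟦δ⟧ : ∀ x → ⟦ 𝔽₂.⟦ x ⟧ ⟧ ≈ ⟦ x ⟧
    ⟦δ⟧ x = reflexive (≡.cong ⟦_⟧ (𝔽₂-⟦⟧ x))

    ⟦term⟧ : ∀ x y u v → ⟦ 𝔽₂.⟦ x ⟧ ∧ (𝔽₂.⟦ y ⟧ ∧ (u ∧ v)) ⟧ ≈ ⟦ x ⟧ *ᴿ (⟦ y ⟧ *ᴿ (⟦ u ⟧ *ᴿ ⟦ v ⟧))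
    ⟦term⟧ x y u v =
      trans (⟦∧⟧ 𝔽₂.⟦ x ⟧ _) (*-cong (⟦δ⟧ x) (trans (⟦∧⟧ 𝔽₂.⟦ y ⟧ _) (*-cong (⟦δ⟧ y) (⟦∧⟧ u v))))

  record InSpan (t : ℕ) (w : ℕ → Carrier) (x : Carrier) : Set ℓ where
    constructor spanned-by
    field
      coeffs    : ℕ → Bool
      expansion : x ≈ ∑[ i < t ] (⟦ coeffs i ⟧ *ᴿ w i)

  module _ {t : ℕ} {w : ℕ → Carrier} where

    InSpan-resp : ∀ {x y} → x ≈ y → InSpan t w x → InSpan t w y
    InSpan-resp x≈y (spanned-by e x≈) = spanned-by e (trans (sym x≈y) x≈)

    InSpan-0 : InSpan t w 0#
    InSpan-0 = spanned-by (λ _ → false) (sym (∑-zero t (λ _ _ → zeroˡ _)))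

    InSpan-generator : ∀ i → i < t → InSpan t w (w i)
    InSpan-generator i i<t = spanned-by (λ l → i ≡ᵇ l) (sym (∑-δ t i w i<t))

    InSpan-+ : ∀ {x y} → InSpan t w x → InSpan t w y → InSpan t w (x +ᴿ y)
    InSpan-+ (spanned-by e x≈) (spanned-by e′ y≈) = spanned-by (λ i → e i xor e′ i) (begin
      _ +ᴿ _                                                    ≈⟨ +-cong x≈ y≈ ⟩
      ∑[ i < t ] (⟦ e i ⟧ *ᴿ w i) +ᴿ ∑[ i < t ] (⟦ e′ i ⟧ *ᴿ w i) ≈⟨ ∑-+ t _ _ ⟨
      ∑[ i < t ] (⟦ e i ⟧ *ᴿ w i +ᴿ ⟦ e′ i ⟧ *ᴿ w i)             ≈⟨ ∑-cong′ t (λ i → distribʳ (w i) _ _) ⟨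
      ∑[ i < t ] ((⟦ e i ⟧ +ᴿ ⟦ e′ i ⟧) *ᴿ w i)                  ≈⟨ ∑-cong′ t (λ i → *-congʳ (⟦xor⟧ (e i) (e′ i))) ⟨
      ∑[ i < t ] (⟦ e i xor e′ i ⟧ *ᴿ w i)                       ∎)

    InSpan-⟦⟧* : ∀ b {x} → InSpan t w x → InSpan t w (⟦ b ⟧ *ᴿ x)
    InSpan-⟦⟧* true  x∈ = InSpan-resp (sym (*-identityˡ _)) x∈
    InSpan-⟦⟧* false x∈ = InSpan-resp (sym (zeroˡ _)) InSpan-0

    InSpan-∑ : ∀ n f → (∀ i → i < n → InSpan t w (f i)) → InSpan t w (∑ n f)
    InSpan-∑ zero    f f∈ = InSpan-0
    InSpan-∑ (suc n) f f∈ = InSpan-+ (InSpan-∑ n f (λ i i<n → f∈ i (ℕ.m<n⇒m<1+n i<n))) (f∈ n (ℕ.n<1+n n))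

  spanned-by-fewer⇒dependent : ∀ n t (v w : ℕ → Carrier) → t < n → (∀ i → InSpan t w (v i)) →
    Σ (ℕ → Bool) λ e → Nontrivial n e × ∑[ i < n ] (⟦ e i ⟧ *ᴿ v i) ≈ 0#
  spanned-by-fewer⇒dependent n t v w t<n v∈ =
    let e , nontrivial , solves = fewer-equations⇒nontrivial-solution n (applyUpTo row t) |rows|<n
    in  e , nontrivial , combination≈0 e (All.applyUpTo⁻ row t solves)
    where
    coord : ℕ → ℕ → Bool
    coord i = InSpan.coeffs (v∈ i)

    row : ℕ → ℕ → Bool
    row l i = coord i l

    |rows|<n : length (applyUpTo row t) < n
    |rows|<n = ≡.subst (_< n) (≡.sym (List.length-applyUpTo row t)) t<n

    combination≈0 : ∀ e → (∀ {l} → l < t → dot n e (row l) ≡ false) → ∑[ i < n ] (⟦ e i ⟧ *ᴿ v i) ≈ 0#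
    combination≈0 e solves = begin
      ∑[ i < n ] (⟦ e i ⟧ *ᴿ v i)
        ≈⟨ ∑-cong′ n (λ i → *-congˡ (InSpan.expansion (v∈ i))) ⟩
      ∑[ i < n ] (⟦ e i ⟧ *ᴿ ∑[ l < t ] (⟦ coord i l ⟧ *ᴿ w l))
        ≈⟨ ∑-cong′ n (λ i → trans (*-distribˡ-∑ t _ _) (∑-cong′ t λ l → sym (*-assoc _ _ _))) ⟩
      ∑[ i < n ] ∑[ l < t ] ((⟦ e i ⟧ *ᴿ ⟦ coord i l ⟧) *ᴿ w l)
        ≈⟨ ∑-comm n t _ ⟩
      ∑[ l < t ] ∑[ i < n ] ((⟦ e i ⟧ *ᴿ ⟦ coord i l ⟧) *ᴿ w l)
        ≈⟨ ∑-cong′ t (λ l → *-distribʳ-∑ n _ _) ⟨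
      ∑[ l < t ] (∑[ i < n ] (⟦ e i ⟧ *ᴿ ⟦ coord i l ⟧) *ᴿ w l)
        ≈⟨ ∑-cong t (λ l l<t → *-congʳ (trans (sym (⟦dot⟧ n e (row l)))
                                              (reflexive (≡.cong ⟦_⟧ (solves l<t))))) ⟩
      ∑[ l < t ] (0# *ᴿ w l)
        ≈⟨ ∑-zero t (λ _ _ → zeroˡ _) ⟩
      0# ∎

  module SpanOfLowerPowers (b : Carrier) (t : ℕ) (b^t∈ : InSpan t (b ^ᴿ_) (b ^ᴿ t)) where

    Span : Carrier → Set ℓ
    Span = InSpan t (b ^ᴿ_)

    pow-≤-InSpan : ∀ i → i ≤ t → Span (b ^ᴿ i)
    pow-≤-InSpan i i≤t with ℕ.m≤n⇒m<n∨m≡n i≤t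
    ... | inj₁ i<t    = InSpan-generator i i<t
    ... | inj₂ ≡.refl = b^t∈

    *b-InSpan : ∀ {x} → Span x → Span (x *ᴿ b)
    *b-InSpan {x} (spanned-by e x≈) =
      InSpan-resp (sym x*b≈) (InSpan-∑ t _ (λ i i<t → InSpan-⟦⟧* (e i) (pow-≤-InSpan (suc i) i<t)))
      where
      x*b≈ : x *ᴿ b ≈ ∑[ i < t ] (⟦ e i ⟧ *ᴿ b ^ᴿ suc i)
      x*b≈ = trans (*-congʳ x≈) (trans (*-distribʳ-∑ t b _) (∑-cong′ t (λ _ → *-assoc _ _ _)))

    *pow-InSpan : ∀ {x} → Span x → ∀ l → Span (x *ᴿ b ^ᴿ l)
    *pow-InSpan x∈ zero    = InSpan-resp (sym (*-identityʳ _)) x∈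
    *pow-InSpan x∈ (suc l) = InSpan-resp (*-assoc _ _ _) (*b-InSpan (*pow-InSpan x∈ l))

    *-InSpan : ∀ {x y} → Span x → Span y → Span (x *ᴿ y)
    *-InSpan {x} {y} x∈ (spanned-by e y≈) =
      InSpan-resp (sym x*y≈) (InSpan-∑ t _ (λ l _ → InSpan-⟦⟧* (e l) (*pow-InSpan x∈ l)))
      where
      x*y≈ : x *ᴿ y ≈ ∑[ l < t ] (⟦ e l ⟧ *ᴿ (x *ᴿ b ^ᴿ l))
      x*y≈ = trans (*-congˡ y≈) (trans (*-distribˡ-∑ t x _) (∑-cong′ t (λ _ → x∙yz≈y∙xz _ _ _)))

    x*x-x-InSpan : ∀ {x} → Span x → Span (x *ᴿ x -ᴿ x)
    x*x-x-InSpan x∈ = InSpan-+ (*-InSpan x∈ x∈) (InSpan-resp (sym (-x≈x _)) x∈)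

    b-InSpan : Span b
    b-InSpan = InSpan-resp (*-identityˡ b) (*b-InSpan (pow-≤-InSpan 0 z≤n))

  module _ {n : ℕ} {β : ℕ → Carrier} (cantor : IsCantorBasis K n β) where
    private
      b : Carrier
      b = β n

    pow∉lower-span : ∀ t → t < n → ¬ InSpan t (b ^ᴿ_) (b ^ᴿ t)
    pow∉lower-span t t<n b^t∈ =
      let e , (j , j<n , e[j]) , ∑≈0 = spanned-by-fewer⇒dependent n t (λ i → β (suc i)) (b ^ᴿ_) t<n
                                          (λ i → everything-InSpan (β (suc i)))
      in  true≢false (≡.trans (≡.sym e[j])
                       (independent e (λ _ → false) (trans ∑≈0 (sym (∑-zero n λ _ _ → zeroˡ _))) j j<n))
      where
      open SpanOfLowerPowers b t b^t∈
      spanning = proj₁ (proj₁ cantor)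
      independent = proj₂ (proj₁ cantor)

      true≢false : true ≢ false
      true≢false ()

      β-InSpan : ∀ i → 1 ≤ i → i ≤ n → Span (β i)
      β-InSpan = cantor-descent K cantor Span InSpan-resp x*x-x-InSpan b-InSpan

      everything-InSpan : ∀ x → Span x
      everything-InSpan x = let e , x≈ = spanning x in
        InSpan-resp (sym x≈) (InSpan-∑ n _ (λ i i<n → InSpan-⟦⟧* (e i) (β-InSpan (suc i) (s≤s z≤n) i<n)))

    ∑-pow≈0⇒false : ∀ m → m ≤ n → ∀ (d : ℕ → Bool) → ∑[ i < m ] (⟦ d i ⟧ *ᴿ b ^ᴿ i) ≈ 0# →
                    ∀ i → i < m → d i ≡ false
    ∑-pow≈0⇒false (suc m) 1+m≤n d ∑≈0 i i<1+m with d m in d[m]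
    ... | true  = ⊥-elim (pow∉lower-span m 1+m≤n
                    (spanned-by d (x+y≈0⇒y≈x (trans (+-congˡ (sym (*-identityˡ _))) ∑≈0))))
    ... | false with ℕ.m≤n⇒m<n∨m≡n (ℕ.≤-pred i<1+m)
    ...   | inj₁ i<m    = ∑-pow≈0⇒false m (ℕ.<⇒≤ 1+m≤n) d lower≈0 i i<m
      where
      lower≈0 : ∑[ i < m ] (⟦ d i ⟧ *ᴿ b ^ᴿ i) ≈ 0#
      lower≈0 = trans (sym (trans (+-congˡ (zeroˡ _)) (+-identityʳ _))) ∑≈0
    ...   | inj₂ ≡.refl = d[m]

    powers-independent : ∀ e e′ → powBasisSum K n b e ≈ powBasisSum K n b e′ → ∀ j → j < n → e j ≡ e′ j
    powers-independent e e′ sums≈ j j<n =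
      xor≡false⇒≡ (e j) (e′ j) (∑-pow≈0⇒false n ℕ.≤-refl (λ i → e i xor e′ i) difference≈0 j j<n)
      where
      difference≈0 : ∑[ i < n ] (⟦ e i xor e′ i ⟧ *ᴿ b ^ᴿ i) ≈ 0#
      difference≈0 = trans (∑-cong′ n (λ i → trans (*-congʳ (⟦xor⟧ (e i) (e′ i))) (distribʳ _ _ _)))
                           (trans (∑-+ n _ _) (trans (+-congʳ sums≈) (x+x≈0 _)))

blocked-multiplication : ∀ {c ℓ} (K : CommutativeRing c ℓ) → Char2 K →
  ∀ {n β} → IsCantorBasis K n β → ∀ N P Q → n ≡ N + N → Q ≡ P + P →
  (a b : ℕ → Bool) → (∀ t → P * N ≤ t → a t ≡ false) → (∀ t → P * N ≤ t → b t ≡ false) →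
  (h : ℕ → ℕ → Bool) →
  (∀ i → i < Q → CommutativeRing._≈_ K (convK K (blockEval K N (β n) a) (blockEval K N (β n) b) i)
                                       (powBasisSum K n (β n) (h i))) →
  ∀ k → mulCoeff a b k ≡ xorSum Q (λ i → xorSum n (λ j → ((N * i + j) ≡ᵇ k) ∧ h i j))
blocked-multiplication K char2 {β = β} cantor N P _ ≡.refl ≡.refl a b a≈0 b≈0 h conv≈ k = begin
  mulCoeff a b k
    ≡⟨ xorSum≡∑ (suc k) _ ⟩
  convK GF₂ a b k
    ≡⟨ 𝔽₂Block.convK-flatten a≈0 b≈0 k ⟩
  𝔽₂.∑ (P + P) (λ i → 𝔽₂.∑ (N + N) (λ j → 𝔽₂.⟦ N * i + j ≡ᵇ k ⟧ ∧ 𝔽₂Block.blockCoeff i j))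
    ≡⟨ 𝔽₂.∑-cong (P + P) (λ i i<2P → 𝔽₂.∑-cong (N + N) (λ j j<2N →
         ≡.cong₂ _∧_ (𝔽₂-⟦⟧ _) (≡.sym (h≡blockCoeff i i<2P j j<2N)))) ⟩
  𝔽₂.∑ (P + P) (λ i → 𝔽₂.∑ (N + N) (λ j → (N * i + j ≡ᵇ k) ∧ h i j))
    ≡⟨ ≡.trans (xorSum≡∑ (P + P) _) (𝔽₂.∑-cong′ (P + P) (λ _ → xorSum≡∑ (N + N) _)) ⟨
  xorSum (P + P) (λ i → xorSum (N + N) (λ j → (N * i + j ≡ᵇ k) ∧ h i j)) ∎
  where
  open ≡.≡-Reasoning
  open CommutativeRing K using (sym; trans; reflexive; *-congʳ)
  open FiniteSums K using (⟦_⟧; ∑-cong′)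
  open Characteristic2 K char2 using (⟦blockCoeff⟧; powers-independent)
  module 𝔽₂Block = BlockProduct GF₂ N P a b
  module KBlock  = BlockProduct K N P (λ t → ⟦ a t ⟧) (λ t → ⟦ b t ⟧)

  h≡blockCoeff : ∀ i → i < P + P → ∀ j → j < N + N → h i j ≡ 𝔽₂Block.blockCoeff i j
  h≡blockCoeff i i<2P = powers-independent cantor (h i) (𝔽₂Block.blockCoeff i)
    (trans (sym (conv≈ i i<2P))
    (trans (KBlock.convK-evalBlock (λ t P*N≤t → reflexive (≡.cong ⟦_⟧ (a≈0 t P*N≤t)))
                                   (λ t P*N≤t → reflexive (≡.cong ⟦_⟧ (b≈0 t P*N≤t))) (β (N + N)) i)
           (∑-cong′ (N + N) (λ j → *-congʳ (sym (⟦blockCoeff⟧ N P a b i j))))))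

lemma5p1 : ∀ {c ℓ : Level} (m : ℕ) → 1 ≤ m →
    (K : CommutativeRing c ℓ) → IsField K → Char2 K →
    (β : ℕ → CommutativeRing.Carrier K) → IsCantorBasis K (2 ^ Lof m) β →
    (a b : Fin (2 ^ m) → Bool) →
    (h : ℕ → ℕ → Bool) →
    (∀ i → i < 2 ^ (m ∸ Lof m + 2) →
      CommutativeRing._≈_ K
        (convK K (blockEval K (2 ^ (Lof m ∸ 1)) (β (2 ^ Lof m)) (extend a))
                 (blockEval K (2 ^ (Lof m ∸ 1)) (β (2 ^ Lof m)) (extend b)) i)
        (powBasisSum K (2 ^ Lof m) (β (2 ^ Lof m)) (h i))) →
    ∀ k → mulCoeff (extend a) (extend b) k
          ≡ xorSum (2 ^ (m ∸ Lof m + 2)) (λ i → xorSum (2 ^ Lof m) (λ j →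
              ((2 ^ (Lof m ∸ 1) * i + j) ≡ᵇ k) ∧ h i j))
lemma5p1 m 1≤m K _ char2 β cantor a b h conv≈ =
  blocked-multiplication K char2 cantor (2 ^ (L ∸ 1)) (2 ^ (m ∸ L + 1)) (2 ^ (m ∸ L + 2))
    2^L≡N+N 2^[m∸L+2]≡P+P (extend a) (extend b) (vanishes a) (vanishes b) h conv≈
  where
  L = Lof m

  1≤L : 1 ≤ L
  1≤L = 1≤Lof 1≤m

  2^L≡N+N : 2 ^ L ≡ 2 ^ (L ∸ 1) + 2 ^ (L ∸ 1)
  2^L≡N+N = ≡.trans (≡.cong (2 ^_) (≡.sym (ℕ.m+[n∸m]≡n 1≤L))) (2^[1+n]≡2^n+2^n (L ∸ 1))

  2^[m∸L+2]≡P+P : 2 ^ (m ∸ L + 2) ≡ 2 ^ (m ∸ L + 1) + 2 ^ (m ∸ L + 1)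
  2^[m∸L+2]≡P+P = ≡.trans (≡.cong (2 ^_) (ℕ.+-suc (m ∸ L) 1)) (2^[1+n]≡2^n+2^n (m ∸ L + 1))

  P*N≡2^m : 2 ^ (m ∸ L + 1) * 2 ^ (L ∸ 1) ≡ 2 ^ m
  P*N≡2^m = ≡.trans (≡.sym (ℕ.^-distribˡ-+-* 2 (m ∸ L + 1) (L ∸ 1))) (≡.cong (2 ^_) (begin
    m ∸ L + 1 + (L ∸ 1)   ≡⟨ ℕ.+-assoc (m ∸ L) 1 (L ∸ 1) ⟩
    m ∸ L + (1 + (L ∸ 1)) ≡⟨ ≡.cong (m ∸ L +_) (ℕ.m+[n∸m]≡n 1≤L) ⟩
    m ∸ L + L             ≡⟨ ℕ.m∸n+n≡m (Lof≤ m) ⟩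
    m                     ∎))
    where open ≡.≡-Reasoning

  vanishes : (e : Fin (2 ^ m) → Bool) → ∀ t → 2 ^ (m ∸ L + 1) * 2 ^ (L ∸ 1) ≤ t → extend e t ≡ false
  vanishes e t P*N≤t = extend-≥ e t (≡.subst (_≤ t) P*N≡2^m P*N≤t)
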